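{- Let $X=(S,\mathcal{L})$ and $Y=(T,\mathcal{L}')$ be pairwise balanced designs and let $f:S\to T$ be a morphism. Then $f$ is an open morphism (i.e. $f(F)$ is a subsystem of $Y$ for every subsystem $F$ of $X$) if and only if for every block $B\in\mathcal{L}$, either $|f(B)|\le 1$ or $f(B)$ is a block of $Y$.
   Context: A PBD is a pair $(S,\mathcal{L})$ with $S$ finite and $\mathcal{L}$ a set of subsets (blocks) of size at least 2 such that every pair of distinct points lies in exactly one block. A subsystem is a set $F$ of points such that for all distinct $x,y\in F$ the block containing them is contained in $F$. For a partial function $f:S\to T$ with domain $S_0$ and $A\subseteq S$, $f(A)=f(A\cap S_0)$, and $f^{ -w}(B)=f^{ -1}(B)\cup(S\setminus S_0)$. $f$ is a morphism if $f^{ -w}(F)$ is a subsystem of $X$ for every subsystem $F$ of $Y$. -}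

module Defs where

open import Data.Nat using (ℕ; _≤_)
open import Data.Bool using (Bool; true; false)
open import Data.Fin using (Fin; _≟_)
open import Data.Fin.Subset using (Subset; _∈_; _⊆_; ∣_∣)
open import Data.Fin.Subset.Properties using (_∈?_)
open import Data.Fin.Properties using (any?)
open import Data.Maybe using (Maybe; just; nothing)
open import Data.Maybe.Properties using (≡-dec)
open import Data.Vec using (tabulate)
open import Data.Product using (Σ; _×_; ∃)
open import Data.Sum using (_⊎_)
open import Relation.Nullary using (¬_; does)
open import Relation.Nullary.Decidable using (_×-dec_)
open import Relation.Binary.PropositionalEquality using (_≡_; _≢_)

-- A pairwise balanced design on the finite point set Fin n.
-- The block set ℒ is given as a predicate on subsets of the points
-- (so it is automatically a *set* of subsets, with no duplicates).
record PBD (n : ℕ) : Set₁ where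
  field
    IsBlock     : Subset n → Set
    blockSize   : ∀ B → IsBlock B → 2 ≤ ∣ B ∣
    pairBlock   : ∀ x y → x ≢ y →
                  Σ (Subset n) λ B → IsBlock B × x ∈ B × y ∈ B ×
                    (∀ B′ → IsBlock B′ → x ∈ B′ → y ∈ B′ → B′ ≡ B)
open PBD public

IsSubsystem : ∀ {n} → PBD n → Subset n → Set
IsSubsystem X F = ∀ x y → x ≢ y → x ∈ F → y ∈ F →
                  ∀ B → IsBlock X B → x ∈ B → y ∈ B → B ⊆ F

-- Partial functions from Fin n to Fin m (nothing = outside the domain S₀).
PartialFun : ℕ → ℕ → Set
PartialFun n m = Fin n → Maybe (Fin m)

image : ∀ {n m} → PartialFun n m → Subset n → Subset m
image f A = tabulate λ y →
  does (any? (λ x → (x ∈? A) ×-dec (≡-dec _≟_ (f x) (just y))))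

-- f^{-w}(B) = f^{-1}(B) ∪ (S ∖ S₀)
weakPreimage : ∀ {n m} → PartialFun n m → Subset m → Subset n
weakPreimage f B = tabulate λ x → go (f x)
  where
  go : Maybe (Fin _) → Bool
  go nothing  = true
  go (just y) = does (y ∈? B)

IsMorphism : ∀ {n m} → PBD n → PBD m → PartialFun n m → Set
IsMorphism X Y f = ∀ F → IsSubsystem Y F → IsSubsystem X (weakPreimage f F)

IsOpen : ∀ {n m} → PBD n → PBD m → PartialFun n m → Set
IsOpen X Y f = ∀ F → IsSubsystem X F → IsSubsystem Y (image f F)

module Submission where

-- Everything rests on one observation about a set p of points: either
-- ∣ p ∣ ≤ 1 or p contains two distinct points; and two distinct points of a
-- PBD lie in a unique block.

open import Defs
open import Data.Nat using (ℕ; _≤_; z≤n; s≤s)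
open import Data.Nat.Properties using (≤-trans; <⇒≱)
open import Data.Bool using (Bool; true)
open import Data.Fin using (Fin; _≟_)
open import Data.Fin.Properties using (any?)
open import Data.Fin.Subset using (Subset; _∈_; _⊆_; ∣_∣; ⊥; ⁅_⁆; _-_)
open import Data.Fin.Subset.Properties
  using (_∈?_; ⊆-refl; ⊆-antisym; nonempty?; p⊆q⇒∣p∣≤∣q∣; ∣⊥∣≡0; ∣⁅x⁆∣≡1; x∈⁅x⁆;
         x∈⁅y⁆⇒x≡y; x≢y⇒x∉⁅y⁆; x∈p∧x∉q⇒x∈p─q; x∈p⇒∣p-x∣<∣p∣)
open import Data.Maybe using (just)
open import Data.Maybe.Properties using (≡-dec; just-injective)
open import Data.Vec using (tabulate; lookup)
open import Data.Vec.Properties using (lookup∘tabulate; []=⇒lookup; lookup⇒[]=)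
open import Data.Product using (Σ; ∃; _×_; _,_)
open import Function using (_∋_)
open import Data.Sum using (_⊎_; inj₁; inj₂)
open import Relation.Nullary using (¬_; ¬?; Dec; yes; no; does; contradiction)
open import Relation.Nullary.Decidable using (_×-dec_; dec-true)
open import Relation.Binary.PropositionalEquality
  using (_≡_; _≢_; refl; sym; trans; subst)

does-true⇒ : ∀ {a} {A : Set a} (a? : Dec A) → does a? ≡ true → A
does-true⇒ (yes a) _ = a

∈-tabulate⁺ : ∀ {n} (g : Fin n → Bool) {x} → g x ≡ true → x ∈ tabulate g
∈-tabulate⁺ g {x} gx≡true = lookup⇒[]= x (tabulate g) (trans (lookup∘tabulate g x) gx≡true)

∈-tabulate⁻ : ∀ {n} (g : Fin n → Bool) {x} → x ∈ tabulate g → g x ≡ true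
∈-tabulate⁻ g {x} x∈ = trans (sym (lookup∘tabulate g x)) ([]=⇒lookup x∈)

TwoPoints : ∀ {m} → Subset m → Set
TwoPoints {m} p = Σ (Fin m) λ u → Σ (Fin m) λ v → u ≢ v × u ∈ p × v ∈ p

twoPoints⇒¬∣p∣≤1 : ∀ {m} {p : Subset m} → TwoPoints p → ¬ (∣ p ∣ ≤ 1)
twoPoints⇒¬∣p∣≤1 {p = p} (u , v , u≢v , u∈p , v∈p) =
  <⇒≱ (≤-trans (s≤s 1≤∣p-u∣) (x∈p⇒∣p-x∣<∣p∣ u∈p))
  where
  ⁅v⁆⊆p-u : ⁅ v ⁆ ⊆ p - u
  ⁅v⁆⊆p-u w∈⁅v⁆ with refl ← x∈⁅y⁆⇒x≡y v w∈⁅v⁆ =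
    x∈p∧x∉q⇒x∈p─q v∈p (x≢y⇒x∉⁅y⁆ (λ v≡u → u≢v (sym v≡u)))
  1≤∣p-u∣ : 1 ≤ ∣ p - u ∣
  1≤∣p-u∣ = subst (_≤ ∣ p - u ∣) (∣⁅x⁆∣≡1 v) (p⊆q⇒∣p∣≤∣q∣ ⁅v⁆⊆p-u)

∣p∣≤1⊎twoPoints : ∀ {m} (p : Subset m) → ∣ p ∣ ≤ 1 ⊎ TwoPoints p
∣p∣≤1⊎twoPoints {m} p with nonempty? p
... | no p-empty = inj₁ (≤-trans (p⊆q⇒∣p∣≤∣q∣ p⊆⊥) (subst (_≤ 1) (sym (∣⊥∣≡0 m)) z≤n))
  where
  p⊆⊥ : p ⊆ ⊥
  p⊆⊥ {w} w∈p = contradiction (w , w∈p) p-empty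
... | yes (u , u∈p) with any? (λ w → (w ∈? p) ×-dec (¬? (w ≟ u)))
...   | yes (v , v∈p , v≢u) = inj₂ (u , v , (λ u≡v → v≢u (sym u≡v)) , u∈p , v∈p)
...   | no ¬other = inj₁ (subst (∣ p ∣ ≤_) (∣⁅x⁆∣≡1 u) (p⊆q⇒∣p∣≤∣q∣ p⊆⁅u⁆))
  where
  p⊆⁅u⁆ : p ⊆ ⁅ u ⁆
  p⊆⁅u⁆ {w} w∈p with w ≟ u
  ... | yes refl = x∈⁅x⁆ u
  ... | no w≢u  = contradiction (w , w∈p , w≢u) ¬other

module _ {n m : ℕ} (f : PartialFun n m) where

  image⁺ : ∀ {A x u} → x ∈ A → f x ≡ just u → u ∈ image f A
  image⁺ {A} {x} {u} x∈A fx≡u =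
    ∈-tabulate⁺ _ (dec-true (any? (λ x → (x ∈? A) ×-dec (≡-dec _≟_ (f x) (just u))))
                            (x , x∈A , fx≡u))

  image⁻ : ∀ {A u} → u ∈ image f A → ∃ λ x → x ∈ A × f x ≡ just u
  image⁻ {A} {u} u∈fA =
    does-true⇒ (any? (λ x → (x ∈? A) ×-dec (≡-dec _≟_ (f x) (just u)))) (∈-tabulate⁻ _ u∈fA)

  image-mono : ∀ {A A′} → A ⊆ A′ → image f A ⊆ image f A′
  image-mono A⊆A′ u∈fA with x , x∈A , fx≡u ← image⁻ u∈fA = image⁺ (A⊆A′ x∈A) fx≡u

  -- The
  -- characteristic function of f^{-w}(L) is local to Defs, so its value at x
  -- is exposed by ascribing the type of lookup∘tabulate.
  weakPreimage⁺ : ∀ {L x u} → f x ≡ just u → u ∈ L → x ∈ weakPreimage f L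
  weakPreimage⁺ {L} {x} fx≡u u∈L
    with f x | lookup (weakPreimage f L) x ≡ _ ∋ lookup∘tabulate _ x
  ... | just v | lookup≡go with refl ← fx≡u =
    lookup⇒[]= x _ (trans lookup≡go (dec-true (v ∈? L) u∈L))

  weakPreimage⁻ : ∀ {L x u} → x ∈ weakPreimage f L → f x ≡ just u → u ∈ L
  weakPreimage⁻ {L} {x} x∈ fx≡u with f x | ∈-tabulate⁻ _ x∈
  ... | just v | go≡true with refl ← fx≡u = does-true⇒ (v ∈? L) go≡true

  distinct-values : ∀ {x y u v} → f x ≡ just u → f y ≡ just v → u ≢ v → x ≢ y
  distinct-values fx≡u fy≡v u≢v refl = u≢v (just-injective (trans (sym fx≡u) fy≡v))

  lift-twoPoints : ∀ {A u v} → u ≢ v → u ∈ image f A → v ∈ image f A →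
                   Σ (Fin n) λ x → Σ (Fin n) λ y →
                     x ≢ y × x ∈ A × y ∈ A × f x ≡ just u × f y ≡ just v
  lift-twoPoints u≢v u∈fA v∈fA
    with x , x∈A , fx≡u ← image⁻ u∈fA | y , y∈A , fy≡v ← image⁻ v∈fA =
    x , y , distinct-values fx≡u fy≡v u≢v , x∈A , y∈A , fx≡u , fy≡v

module _ {n : ℕ} (X : PBD n) where

  block-unique : ∀ {x y B B′} → x ≢ y → IsBlock X B → x ∈ B → y ∈ B →
                 IsBlock X B′ → x ∈ B′ → y ∈ B′ → B ≡ B′
  block-unique {x} {y} x≢y B-block x∈B y∈B B′-block x∈B′ y∈B′
    with _ , _ , _ , _ , unique ← pairBlock X x y x≢y =
    trans (unique _ B-block x∈B y∈B) (sym (unique _ B′-block x∈B′ y∈B′))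

  block-subsystem : ∀ {B} → IsBlock X B → IsSubsystem X B
  block-subsystem {B} B-block x y x≢y x∈B y∈B B′ B′-block x∈B′ y∈B′ =
    subst (_⊆ B) (block-unique x≢y B-block x∈B y∈B B′-block x∈B′ y∈B′) ⊆-refl

BlockImages : ∀ {n m} → PBD n → PBD m → PartialFun n m → Set
BlockImages X Y f = ∀ B → IsBlock X B → ∣ image f B ∣ ≤ 1 ⊎ IsBlock Y (image f B)

module _ {n m : ℕ} (X : PBD n) (Y : PBD m) (f : PartialFun n m) where

  -- Indeed f^{-w}(F) is
  -- a subsystem containing two points of the block, hence the block itself.
  morphism-blockImage⊆ : IsMorphism X Y f → ∀ {B F u v} → IsBlock X B → IsSubsystem Y F →
                         u ≢ v → u ∈ image f B → v ∈ image f B → u ∈ F → v ∈ F →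
                         image f B ⊆ F
  morphism-blockImage⊆ f-morphism {B} {F} B-block F-subsystem u≢v u∈fB v∈fB u∈F v∈F w∈fB
    with x , y , x≢y , x∈B , y∈B , fx≡u , fy≡v ← lift-twoPoints f u≢v u∈fB v∈fB
       | z , z∈B , fz≡w ← image⁻ f w∈fB =
    weakPreimage⁻ f (B⊆f⁻ʷF z∈B) fz≡w
    where
    B⊆f⁻ʷF : B ⊆ weakPreimage f F
    B⊆f⁻ʷF = f-morphism F F-subsystem x y x≢y
               (weakPreimage⁺ f fx≡u u∈F) (weakPreimage⁺ f fy≡v v∈F) B B-block x∈B y∈B

  -- (⇒) For an open morphism, a block image with two distinct points u, v
  -- contains the block L through them (it is a subsystem) and lies in L
  -- (key lemma), so it equals L.
  open⇒blockImages : IsMorphism X Y f → IsOpen X Y f → BlockImages X Y f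
  open⇒blockImages f-morphism f-open B B-block with ∣p∣≤1⊎twoPoints (image f B)
  ... | inj₁ small = inj₁ small
  ... | inj₂ (u , v , u≢v , u∈fB , v∈fB)
    with L , L-block , u∈L , v∈L , _ ← pairBlock Y u v u≢v =
    inj₂ (subst (IsBlock Y) (⊆-antisym L⊆fB fB⊆L) L-block)
    where
    L⊆fB : L ⊆ image f B
    L⊆fB = f-open B (block-subsystem X B-block) u v u≢v u∈fB v∈fB L L-block u∈L v∈L
    fB⊆L : image f B ⊆ L
    fB⊆L = morphism-blockImage⊆ f-morphism B-block (block-subsystem Y L-block)
             u≢v u∈fB v∈fB u∈L v∈L

  blockImages-twoPoints : BlockImages X Y f → ∀ {B} → IsBlock X B →
                          TwoPoints (image f B) → IsBlock Y (image f B)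
  blockImages-twoPoints images B-block two with images _ B-block
  ... | inj₁ small   = contradiction small (twoPoints⇒¬∣p∣≤1 two)
  ... | inj₂ fB-block = fB-block

  -- (⇐) For a subsystem F and distinct u, v ∈ f(F) with preimages x, y ∈ F,
  -- the block B through x, y lies in F and f(B) is the block L through u, v;
  -- hence L = f(B) ⊆ f(F).  This direction does not need f to be a morphism.
  blockImages⇒open : BlockImages X Y f → IsOpen X Y f
  blockImages⇒open images F F-subsystem u v u≢v u∈fF v∈fF L L-block u∈L v∈L
    with x , y , x≢y , x∈F , y∈F , fx≡u , fy≡v ← lift-twoPoints f u≢v u∈fF v∈fF
    with B , B-block , x∈B , y∈B , _ ← pairBlock X x y x≢y =
    subst (_⊆ image f F) fB≡L (image-mono f B⊆F)
    where
    B⊆F : B ⊆ F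
    B⊆F = F-subsystem x y x≢y x∈F y∈F B B-block x∈B y∈B
    u∈fB : u ∈ image f B
    u∈fB = image⁺ f x∈B fx≡u
    v∈fB : v ∈ image f B
    v∈fB = image⁺ f y∈B fy≡v
    fB≡L : image f B ≡ L
    fB≡L = block-unique Y u≢v
             (blockImages-twoPoints images B-block (u , v , u≢v , u∈fB , v∈fB)) u∈fB v∈fB
             L-block u∈L v∈L

proposition6p4 : ∀ {n m} (X : PBD n) (Y : PBD m) (f : PartialFun n m) →
    IsMorphism X Y f →
    (IsOpen X Y f → ∀ B → IsBlock X B → ∣ image f B ∣ ≤ 1 ⊎ IsBlock Y (image f B)) ×
    ((∀ B → IsBlock X B → ∣ image f B ∣ ≤ 1 ⊎ IsBlock Y (image f B)) → IsOpen X Y f)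
proposition6p4 X Y f f-morphism =
  open⇒blockImages X Y f f-morphism , blockImages⇒open X Y f
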